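{- Let $\Gamma$ be a distance-regular antipodal double cover with diameter $D\ge3$, let $x$ be a vertex of $\Gamma$ and $\hat x$ its antipode. Then a subspace $W$ of $\mathbb{C}^X$ is an irreducible $T(x)$-module if and only if it is an irreducible $T(\hat x)$-module.
   Context: A finite simple connected graph with vertex set $X$, distance $\partial$ and diameter $D$ is distance-regular if for all $h,i,j$ and $x,y$ with $\partial(x,y)=h$ the number $|\{z:\partial(x,z)=i,\partial(y,z)=j\}|$ depends only on $h,i,j$. It is an antipodal double cover if every vertex $x$ has exactly one vertex $\hat x$ (its antipode) at distance $D$ from it. With $A$ the adjacency matrix, $E^*_i(x)$ ($0\le i\le D$) is the diagonal $0/1$ matrix with $(E^*_i(x))_{yy}=1$ iff $\partial(x,y)=i$, and the Terwilliger algebra $T(x)$ is the subalgebra of $\mathrm{Mat}_X(\mathbb{C})$ generated by $A,E^*_0(x),\dots,E^*_D(x)$. A $T(x)$-module is a subspace $W\subseteq\mathbb{C}^X$ with $BW\subseteq W$ for all $B\in T(x)$; irreducible means nonzero with no nonzero proper submodule. -}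

module Defs where

open import Level using (Level; _⊔_; suc)
open import Data.Nat as ℕ using (ℕ; zero; _≤_; _∸_)
open import Data.Fin using (Fin)
open import Data.Fin.Properties using (_≟_)
open import Data.Bool using (Bool; true; false; _∨_; _∧_; not)
open import Data.List using (List; upTo; map; sum)
open import Data.Vec.Functional using (foldr)
open import Data.Product using (Σ; ∃; _×_; _,_)
open import Data.Empty using (⊥)
open import Relation.Nullary using (¬_; Dec; yes; no)
open import Relation.Binary.PropositionalEquality using (_≡_)
open import Algebra.Bundles using (CommutativeRing)

record Graph (n : ℕ) : Set where
  field
    adj   : Fin n → Fin n → Bool

anyFin : ∀ {n} → (Fin n → Bool) → Bool
anyFin {n} p = foldr _∨_ false p

Reach : ∀ {n} → Graph n → ℕ → Fin n → Fin n → Bool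
Reach G zero    x y = Dec.does (x ≟ y)
Reach G (ℕ.suc k) x y = Reach G k x y ∨ anyFin (λ z → Graph.adj G x z ∧ Reach G k z y)

countUnreached : ∀ {n} → Graph n → ℕ → Fin n → Fin n → ℕ
countUnreached G zero      x y = 0
countUnreached G (ℕ.suc m) x y with Reach G m x y
... | true  = countUnreached G m x y
... | false = ℕ.suc (countUnreached G m x y)

-- Path distance ∂(x,y): for a connected graph on n vertices, the least k
-- with Reach G k x y = true (Reach is monotone in k and every distance is < n).
dist : ∀ {n} → Graph n → Fin n → Fin n → ℕ
dist {n} G x y = countUnreached G n x y

record IsSimpleConnected {n} (G : Graph n) : Set where
  open Graph G
  field
    symmetric   : ∀ x y → adj x y ≡ adj y x
    irreflexive : ∀ x → adj x x ≡ false
    connected   : ∀ x y → ∃ λ k → Reach G k x y ≡ true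

IsDiameter : ∀ {n} → Graph n → ℕ → Set
IsDiameter G D = (∀ x y → dist G x y ≤ D) × (∃ λ x → ∃ λ y → dist G x y ≡ D)

card : ∀ {n} → (Fin n → Bool) → ℕ
card p = foldr (λ b c → if′ b c) 0 p
  where
  if′ : Bool → ℕ → ℕ
  if′ true  c = ℕ.suc c
  if′ false c = c

eqℕ : ℕ → ℕ → Bool
eqℕ a b = Dec.does (a ℕ.≟ b)

intersectionCount : ∀ {n} → Graph n → ℕ → ℕ → Fin n → Fin n → ℕ
intersectionCount G i j x y = card (λ z → eqℕ (dist G x z) i ∧ eqℕ (dist G y z) j)

IsDistanceRegular : ∀ {n} → Graph n → Set
IsDistanceRegular G =
  IsSimpleConnected G ×
  (∀ h i j x y x′ y′ → dist G x y ≡ h → dist G x′ y′ ≡ h →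
     intersectionCount G i j x y ≡ intersectionCount G i j x′ y′)

IsAntipodalDoubleCover : ∀ {n} → Graph n → ℕ → Set
IsAntipodalDoubleCover G D =
  ∀ x → ∃ λ x̂ → (dist G x x̂ ≡ D) × (∀ z → dist G x z ≡ D → z ≡ x̂)

record Field (c ℓ : Level) : Set (suc (c ⊔ ℓ)) where
  field
    commutativeRing : CommutativeRing c ℓ
  open CommutativeRing commutativeRing public
  field
    1≉0     : ¬ (1# ≈ 0#)
    inverse : ∀ a → ¬ (a ≈ 0#) → ∃ λ b → (a * b) ≈ 1#

module LinAlg {c ℓ : Level} (F : Field c ℓ) where
  open Field F

  Vector : ℕ → Set c
  Vector n = Fin n → Carrier

  Matrix : ℕ → Set c
  Matrix n = Fin n → Fin n → Carrier

  ∑ : ∀ {n} → (Fin n → Carrier) → Carrier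
  ∑ f = foldr _+_ 0# f

  _≈ᵥ_ : ∀ {n} → Vector n → Vector n → Set ℓ
  u ≈ᵥ v = ∀ i → u i ≈ v i

  _≈ₘ_ : ∀ {n} → Matrix n → Matrix n → Set ℓ
  M ≈ₘ N = ∀ i j → M i j ≈ N i j

  0ᵥ : ∀ {n} → Vector n
  0ᵥ _ = 0#

  _+ᵥ_ : ∀ {n} → Vector n → Vector n → Vector n
  (u +ᵥ v) i = u i + v i

  _·ᵥ_ : ∀ {n} → Carrier → Vector n → Vector n
  (a ·ᵥ v) i = a * v i

  _+ₘ_ : ∀ {n} → Matrix n → Matrix n → Matrix n
  (M +ₘ N) i j = M i j + N i j

  _·ₘ_ : ∀ {n} → Carrier → Matrix n → Matrix n
  (a ·ₘ M) i j = a * M i j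

  _*ₘ_ : ∀ {n} → Matrix n → Matrix n → Matrix n
  (M *ₘ N) i j = ∑ (λ k → M i k * N k j)

  1ₘ : ∀ {n} → Matrix n
  1ₘ i j = if (Dec.does (i ≟ j)) then 1# else 0#
    where open import Data.Bool using (if_then_else_)

  _∙_ : ∀ {n} → Matrix n → Vector n → Vector n
  (M ∙ v) i = ∑ (λ k → M i k * v k)

  fromBool : Bool → Carrier
  fromBool true  = 1#
  fromBool false = 0#

  adjMatrix : ∀ {n} → Graph n → Matrix n
  adjMatrix G y z = fromBool (Graph.adj G y z)

  dualIdem : ∀ {n} → Graph n → Fin n → ℕ → Matrix n
  dualIdem G x i y z = fromBool (Dec.does (y ≟ z) ∧ eqℕ (dist G x y) i)

  data InT {n} (G : Graph n) (D : ℕ) (x : Fin n) : Matrix n → Set (c ⊔ ℓ) where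
    gen-A  : InT G D x (adjMatrix G)
    gen-E  : ∀ i → i ≤ D → InT G D x (dualIdem G x i)
    gen-1  : InT G D x 1ₘ
    cl-+   : ∀ {M N} → InT G D x M → InT G D x N → InT G D x (M +ₘ N)
    cl-·   : ∀ {M} a → InT G D x M → InT G D x (a ·ₘ M)
    cl-*   : ∀ {M N} → InT G D x M → InT G D x N → InT G D x (M *ₘ N)
    cl-≈   : ∀ {M N} → M ≈ₘ N → InT G D x M → InT G D x N

  record IsSubspace {p} {n} (W : Vector n → Set p) : Set (c ⊔ ℓ ⊔ p) where
    field
      resp-≈ : ∀ {u v} → u ≈ᵥ v → W u → W v
      zero∈  : W 0ᵥ
      +-cl   : ∀ {u v} → W u → W v → W (u +ᵥ v)
      ·-cl   : ∀ a {v} → W v → W (a ·ᵥ v)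

  IsTModule : ∀ {p} {n} → Graph n → ℕ → Fin n → (Vector n → Set p) → Set (c ⊔ ℓ ⊔ p)
  IsTModule G D x W =
    IsSubspace W × (∀ B → InT G D x B → ∀ w → W w → W (B ∙ w))

  Nonzero : ∀ {p} {n} → (Vector n → Set p) → Set (c ⊔ ℓ ⊔ p)
  Nonzero W = ∃ λ w → W w × ¬ (w ≈ᵥ 0ᵥ)

  IsIrreducibleTModule : ∀ {p} {n} → Graph n → ℕ → Fin n → (Vector n → Set p) → Set (c ⊔ ℓ ⊔ suc p)
  IsIrreducibleTModule {p} {n} G D x W =
    IsTModule G D x W × Nonzero W ×
    (∀ (U : Vector n → Set p) → IsTModule G D x U → (∀ v → U v → W v) →
       ¬ (Nonzero U × (∃ λ w → W w × ¬ U w)))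

-- If x̂ is the antipode of x, then ∂(x̂,y) = D − ∂(x,y) for every vertex y: a
-- vertex v on a geodesic from x to x̂ with ∂(x,v) = ∂(x,y) has x̂ at distances
-- (D, D − ∂(x,y)) from (x,v), so by distance-regularity some z is at distances
-- (D, D − ∂(x,y)) from (x,y), and z = x̂ since x̂ is the only vertex at distance
-- D from x. Hence E*_i(x̂) = E*_{D−i}(x), so T(x) = T(x̂), and the two algebras
-- have the same irreducible modules.
--
-- Since ∂ is defined by counting failed reachability tests up to radius n, it
-- is first identified with the length of a shortest walk; that this length is
-- below n holds because the balls around a vertex grow strictly until they stop
-- growing for good.
module Submission where

open import Level using (Level)
open import Data.Bool using (Bool; true; false; _∨_; _∧_; T)
open import Data.Bool.Properties using (∨-zeroʳ)
open import Data.Fin using (Fin) renaming (zero to fzero; suc to fsuc)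
open import Data.Fin.Properties using (_≟_)
open import Data.Nat as ℕ using (ℕ; zero; suc; _≤_; _<_; _+_; _∸_; _⊓_; z≤n; s≤s; _≤?_)
open import Data.Nat.Properties hiding (_≟_)
open import Data.Product using (∃; _×_; _,_; proj₁; proj₂)
open import Function.Base using (_∘_)
open import Function.Bundles using (_⇔_; mk⇔)
open import Relation.Nullary using (yes; no; does; contradiction)
open import Relation.Nullary.Decidable using (dec-true; does-⇔)
open import Relation.Binary.PropositionalEquality
open import Relation.Unary using (_⊆_; _≐_)
open import Relation.Unary.Properties using (≐-sym)
open import Defs

_⊆ᵇ_ : ∀ {n} → (Fin n → Bool) → (Fin n → Bool) → Set
p ⊆ᵇ q = ∀ z → p z ≡ true → q z ≡ true

∧≡true⇒× : ∀ {a b} → a ∧ b ≡ true → a ≡ true × b ≡ true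
∧≡true⇒× {true} {true} _ = refl , refl
∧≡true⇒× {true} {false} ()
∧≡true⇒× {false} ()

eqℕ-complete : ∀ {a b} → a ≡ b → eqℕ a b ≡ true
eqℕ-complete {a} {b} = dec-true (a ℕ.≟ b)

eqℕ-sound : ∀ {a b} → eqℕ a b ≡ true → a ≡ b
eqℕ-sound {a} {b} e = ≡ᵇ⇒≡ a b (subst T (sym e) _)

eqℕ-∸-swap : ∀ {D a i} → a ≤ D → i ≤ D → eqℕ a (D ∸ i) ≡ eqℕ (D ∸ a) i
eqℕ-∸-swap {D} {a} {i} a≤D i≤D = does-⇔ (mk⇔ to from) (a ℕ.≟ D ∸ i) (D ∸ a ℕ.≟ i)
  where
  to : a ≡ D ∸ i → D ∸ a ≡ i
  to e = trans (cong (D ∸_) e) (m∸[m∸n]≡n i≤D)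
  from : D ∸ a ≡ i → a ≡ D ∸ i
  from e = trans (sym (m∸[m∸n]≡n a≤D)) (cong (D ∸_) e)

anyFin-sound : ∀ {n} (p : Fin n → Bool) → anyFin p ≡ true → ∃ λ z → p z ≡ true
anyFin-sound {suc n} p e with p fzero in e₀
... | true  = fzero , e₀
... | false with z , pz ← anyFin-sound (p ∘ fsuc) e = fsuc z , pz

anyFin-complete : ∀ {n} (p : Fin n → Bool) z → p z ≡ true → anyFin p ≡ true
anyFin-complete p fzero e rewrite e = refl
anyFin-complete p (fsuc z) e with p fzero
... | true  = refl
... | false = anyFin-complete (p ∘ fsuc) z e

anyFin-cong : ∀ {n} {p q : Fin n → Bool} → p ≗ q → anyFin p ≡ anyFin q
anyFin-cong {zero}  h = refl
anyFin-cong {suc n} h = cong₂ _∨_ (h fzero) (anyFin-cong (h ∘ fsuc))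

card≤n : ∀ {n} (p : Fin n → Bool) → card p ≤ n
card≤n {zero}  p = z≤n
card≤n {suc n} p with p fzero
... | true  = s≤s (card≤n (p ∘ fsuc))
... | false = m≤n⇒m≤1+n (card≤n (p ∘ fsuc))

card-mono : ∀ {n} {p q : Fin n → Bool} → p ⊆ᵇ q → card p ≤ card q
card-mono {zero}          p⊆q = z≤n
card-mono {suc n} {p} {q} p⊆q with p fzero in e₁ | q fzero in e₂
... | true  | true  = s≤s (card-mono (p⊆q ∘ fsuc))
... | false | true  = m≤n⇒m≤1+n (card-mono (p⊆q ∘ fsuc))
... | false | false = card-mono (p⊆q ∘ fsuc)
... | true  | false with () ← trans (sym (p⊆q fzero e₁)) e₂

card-mono-≡⇒≗ : ∀ {n} {p q : Fin n → Bool} → p ⊆ᵇ q → card p ≡ card q → p ≗ q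
card-mono-≡⇒≗ {suc n} {p} {q} p⊆q c z with p fzero in e₁ | q fzero in e₂
card-mono-≡⇒≗ p⊆q c fzero    | true  | true  = trans e₁ (sym e₂)
card-mono-≡⇒≗ p⊆q c (fsuc z) | true  | true  = card-mono-≡⇒≗ (p⊆q ∘ fsuc) (suc-injective c) z
card-mono-≡⇒≗ p⊆q c fzero    | false | false = trans e₁ (sym e₂)
card-mono-≡⇒≗ p⊆q c (fsuc z) | false | false = card-mono-≡⇒≗ (p⊆q ∘ fsuc) c z
... | true  | false with () ← trans (sym (p⊆q fzero e₁)) e₂
... | false | true  = contradiction c (<⇒≢ (s≤s (card-mono (p⊆q ∘ fsuc))))

card-pos : ∀ {n} (p : Fin n → Bool) z → p z ≡ true → 1 ≤ card p
card-pos p fzero e rewrite e = s≤s z≤n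
card-pos p (fsuc z) e with p fzero
... | true  = s≤s z≤n
... | false = card-pos (p ∘ fsuc) z e

card-pos⇒∃ : ∀ {n} (p : Fin n → Bool) → 1 ≤ card p → ∃ λ z → p z ≡ true
card-pos⇒∃ {suc n} p c with p fzero in e₀
... | true  = fzero , e₀
... | false with z , pz ← card-pos⇒∃ (p ∘ fsuc) c = fsuc z , pz

module Walks {n} (G : Graph n) where
  open Graph G

  data Walk : ℕ → Fin n → Fin n → Set where
    []  : ∀ {x} → Walk 0 x x
    _∷_ : ∀ {k x z y} → adj x z ≡ true → Walk k z y → Walk (suc k) x y

  _++_ : ∀ {i j x v y} → Walk i x v → Walk j v y → Walk (i + j) x y
  []      ++ b = b
  (e ∷ a) ++ b = e ∷ (a ++ b)

  _∷ʳ_ : ∀ {k x v y} → Walk k x v → adj v y ≡ true → Walk (suc k) x y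
  []      ∷ʳ e′ = e′ ∷ []
  (e ∷ a) ∷ʳ e′ = e ∷ (a ∷ʳ e′)

  reverse : (∀ x y → adj x y ≡ adj y x) → ∀ {k x y} → Walk k x y → Walk k y x
  reverse symmetric []                          = []
  reverse symmetric {x = x} (_∷_ {z = z} e a) = reverse symmetric a ∷ʳ trans (symmetric z x) e

  splitAt : ∀ i {j x y} → Walk (i + j) x y → ∃ λ v → Walk i x v × Walk j v y
  splitAt zero    {x = x} a = x , [] , a
  splitAt (suc i) (e ∷ a) with v , b , c ← splitAt i a = v , e ∷ b , c

  Reach-suc : ∀ {k x y} → Reach G k x y ≡ true → Reach G (suc k) x y ≡ true
  Reach-suc e rewrite e = refl

  Reach⇒Walk : ∀ k {x y} → Reach G k x y ≡ true → ∃ λ j → j ≤ k × Walk j x y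
  Reach⇒Walk zero {x} {y} e with x ≟ y
  ... | yes refl = 0 , z≤n , []
  Reach⇒Walk zero () | no _
  Reach⇒Walk (suc k) {x} {y} e with Reach G k x y in e₁
  ... | true with j , j≤k , a ← Reach⇒Walk k e₁ = j , m≤n⇒m≤1+n j≤k , a
  ... | false = throughNeighbour (anyFin-sound (λ z → adj x z ∧ Reach G k z y) e)
    where
    throughNeighbour : (∃ λ z → adj x z ∧ Reach G k z y ≡ true) → ∃ λ j → j ≤ suc k × Walk j x y
    throughNeighbour (z , e₂) =
      let (xz , zy)     = ∧≡true⇒× e₂
          (j , j≤k , a) = Reach⇒Walk k zy
      in suc j , s≤s j≤k , xz ∷ a

  Walk⇒Reach : ∀ {j x y} → Walk j x y → ∀ {k} → j ≤ k → Reach G k x y ≡ true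
  Walk⇒Reach {x = x} [] {zero}  _ = dec-true (x ≟ x) refl
  Walk⇒Reach {x = x} [] {suc k} _ = Reach-suc {k} {x} (Walk⇒Reach [] {k} z≤n)
  Walk⇒Reach {x = x} {y} (_∷_ {z = z} e a) {suc k} (s≤s j≤k) =
    trans (cong (Reach G k x y ∨_) (anyFin-complete (λ z′ → adj x z′ ∧ Reach G k z′ y) z zReach))
          (∨-zeroʳ (Reach G k x y))
    where
    zReach : adj x z ∧ Reach G k z y ≡ true
    zReach rewrite e = Walk⇒Reach a j≤k

  IsWalkDistance : ℕ → Fin n → Fin n → Set
  IsWalkDistance m x y = Walk m x y × (∀ {j} → Walk j x y → m ≤ j)

  walkDistance-unique : ∀ {m m′ x y} → IsWalkDistance m x y → IsWalkDistance m′ x y → m ≡ m′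
  walkDistance-unique (a , min) (a′ , min′) = ≤-antisym (min a′) (min′ a)

  walkDistance-sym : (∀ x y → adj x y ≡ adj y x) →
                     ∀ {m x y} → IsWalkDistance m x y → IsWalkDistance m y x
  walkDistance-sym symmetric (a , min) = reverse symmetric a , min ∘ reverse symmetric

  walkDistance-splitAt : ∀ {i j x v y} → IsWalkDistance (i + j) x y → Walk i x v → Walk j v y →
                         IsWalkDistance i x v × IsWalkDistance j v y
  walkDistance-splitAt {i} {j} (_ , min) a b =
    (a , λ a′ → +-cancelʳ-≤ j i _ (min (a′ ++ b))) ,
    (b , λ b′ → +-cancelˡ-≤ i j _ (min (a ++ b′)))

  walkDistance-split : ∀ {m x y} → IsWalkDistance m x y → ∀ i → i ≤ m →
                       ∃ λ v → IsWalkDistance i x v × IsWalkDistance (m ∸ i) v y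
  walkDistance-split {m} {x} {y} d i i≤m =
    let d′        = subst (λ k → IsWalkDistance k x y) (sym (m+[n∸m]≡n i≤m)) d
        (v , a , b) = splitAt i (proj₁ d′)
    in v , walkDistance-splitAt d′ a b

  Reach⇒walkDistance≤ : ∀ {m x y} → IsWalkDistance m x y → ∀ {k} → Reach G k x y ≡ true → m ≤ k
  Reach⇒walkDistance≤ (_ , min) {k} e with j , j≤k , a ← Reach⇒Walk k e = ≤-trans (min a) j≤k

  Reach⇒∃walkDistance : ∀ k {x y} → Reach G k x y ≡ true → ∃ λ m → IsWalkDistance m x y
  Reach⇒∃walkDistance zero e with j , j≤0 , a ← Reach⇒Walk zero e = j , a , λ _ → ≤-trans j≤0 z≤n
  Reach⇒∃walkDistance (suc k) {x} {y} e with Reach⇒Walk (suc k) e | Reach G k x y in e₁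
  ... | _               | true  = Reach⇒∃walkDistance k e₁
  ... | j , j≤1+k , a | false = j , a , shortest
    where
    shortest : ∀ {j′} → Walk j′ x y → j ≤ j′
    shortest {j′} a′ with j′ ≤? k
    ... | yes j′≤k with () ← trans (sym (Walk⇒Reach a′ j′≤k)) e₁
    ... | no  j′≰k = ≤-trans j≤1+k (≰⇒> j′≰k)

  countUnreached≡⊓ : ∀ {m x y} → IsWalkDistance m x y → ∀ N → countUnreached G N x y ≡ N ⊓ m
  countUnreached≡⊓ d zero = refl
  countUnreached≡⊓ {m} {x} {y} d (suc N) with Reach G N x y in e
  ... | true = begin
    countUnreached G N x y ≡⟨ countUnreached≡⊓ d N ⟩
    N ⊓ m                  ≡⟨ m≥n⇒m⊓n≡n m≤N ⟩
    m                      ≡⟨ m≥n⇒m⊓n≡n (m≤n⇒m≤1+n m≤N) ⟨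
    suc N ⊓ m              ∎
    where
    open ≡-Reasoning
    m≤N : m ≤ N
    m≤N = Reach⇒walkDistance≤ d e
  ... | false = begin
    suc (countUnreached G N x y) ≡⟨ cong suc (countUnreached≡⊓ d N) ⟩
    suc (N ⊓ m)                  ≡⟨ cong suc (m≤n⇒m⊓n≡m (<⇒≤ N<m)) ⟩
    suc N                        ≡⟨ m≤n⇒m⊓n≡m N<m ⟨
    suc N ⊓ m                    ∎
    where
    open ≡-Reasoning
    N<m : N < m
    N<m = ≰⇒> λ m≤N → contradiction (trans (sym (Walk⇒Reach (proj₁ d) m≤N)) e) λ ()

  ball : Fin n → ℕ → Fin n → Bool
  ball y k z = Reach G k z y

  ball-suc-cong : ∀ y k k′ → ball y k ≗ ball y k′ → ball y (suc k) ≗ ball y (suc k′)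
  ball-suc-cong y k k′ h z = cong₂ _∨_ (h z) (anyFin-cong λ w → cong (adj z w ∧_) (h w))

  ball-stable : ∀ y k → ball y (suc k) ≗ ball y k → ∀ t → ball y (t + k) ≗ ball y k
  ball-stable y k h zero    z = refl
  ball-stable y k h (suc t) z = trans (ball-suc-cong y (t + k) k (ball-stable y k h t) z) (h z)

  -- Up to radius m the balls around y grow strictly, because a ball that stops
  -- growing never grows again and would miss x.
  ball-card-growth : ∀ {m x y} → IsWalkDistance m x y → ∀ k → k ≤ m → suc k ≤ card (ball y k)
  ball-card-growth {y = y} d zero _ = card-pos (ball y 0) y (Walk⇒Reach {x = y} [] {0} z≤n)
  ball-card-growth {m} {x} {y} d (suc k) k<m =
    ≤-<-trans (ball-card-growth d k (<⇒≤ k<m)) (≤∧≢⇒< (card-mono ball-⊆) ball-grows)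
    where
    ball-⊆ : ball y k ⊆ᵇ ball y (suc k)
    ball-⊆ z = Reach-suc {k} {z} {y}
    ball-grows : card (ball y k) ≢ card (ball y (suc k))
    ball-grows c = <⇒≱ k<m (Reach⇒walkDistance≤ d x∈ball)
      where
      x∈ball : ball y k x ≡ true
      x∈ball = begin
        ball y k x            ≡⟨ ball-stable y k (sym ∘ card-mono-≡⇒≗ ball-⊆ c) (m ∸ k) x ⟨
        ball y (m ∸ k + k) x  ≡⟨ Walk⇒Reach (proj₁ d) (≤-reflexive (sym (m∸n+n≡m (<⇒≤ k<m)))) ⟩
        true                  ∎
        where open ≡-Reasoning

  walkDistance<n : ∀ {m x y} → IsWalkDistance m x y → m < n
  walkDistance<n {m} {y = y} d = ≤-trans (ball-card-growth d m ≤-refl) (card≤n (ball y m))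

  dist-isWalkDistance : (∀ x y → ∃ λ k → Reach G k x y ≡ true) → ∀ x y → IsWalkDistance (dist G x y) x y
  dist-isWalkDistance connected x y
    with m , d ← Reach⇒∃walkDistance (proj₁ (connected x y)) (proj₂ (connected x y))
    = subst (λ k → IsWalkDistance k x y) (sym dist≡m) d
    where
    dist≡m : dist G x y ≡ m
    dist≡m = trans (countUnreached≡⊓ d n) (m≥n⇒m⊓n≡n (<⇒≤ (walkDistance<n d)))

module ConnectedDistance {n} {G : Graph n} (simple : IsSimpleConnected G) where
  open Walks G
  open IsSimpleConnected simple

  dist≡walkDistance : ∀ {m x y} → IsWalkDistance m x y → dist G x y ≡ m
  dist≡walkDistance {x = x} {y} = walkDistance-unique (dist-isWalkDistance connected x y)

  dist-sym : ∀ x y → dist G x y ≡ dist G y x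
  dist-sym x y = dist≡walkDistance (walkDistance-sym symmetric (dist-isWalkDistance connected y x))

  geodesic-point : ∀ {x y} i → i ≤ dist G x y →
                   ∃ λ v → dist G x v ≡ i × dist G v y ≡ dist G x y ∸ i
  geodesic-point {x} {y} i i≤d =
    let (v , xv , vy) = walkDistance-split (dist-isWalkDistance connected x y) i i≤d
    in v , dist≡walkDistance xv , dist≡walkDistance vy

module AntipodalDistanceRegular {n} {G : Graph n} {D : ℕ} (regular : IsDistanceRegular G)
  (diameter : IsDiameter G D) (antipodal : IsAntipodalDoubleCover G D) where
  open ConnectedDistance (proj₁ regular)

  dist-antipode : ∀ {x x̂} → dist G x x̂ ≡ D → ∀ y → dist G x̂ y ≡ D ∸ dist G x y
  dist-antipode {x} {x̂} xx̂≡D y =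
    let i                 = dist G x y
        (v , xv≡i , vx̂≡) = geodesic-point i (subst (i ≤_) (sym xx̂≡D) (proj₁ diameter x y))
        x̂∈p[x,v]         = card-pos _ x̂ (cong₂ _∧_ (eqℕ-complete xx̂≡D)
                                                  (eqℕ-complete (subst (λ d → dist G v x̂ ≡ d ∸ i) xx̂≡D vx̂≡)))
        p[x,y]≡p[x,v]     = proj₂ regular i D (D ∸ i) x y x v refl xv≡i
        (z , z∈p[x,y])    = card-pos⇒∃ _ (subst (1 ≤_) (sym p[x,y]≡p[x,v]) x̂∈p[x,v])
        (xz≡D , yz≡D∸i)   = ∧≡true⇒× z∈p[x,y]
    in begin
      dist G x̂ y  ≡⟨ dist-sym x̂ y ⟩
      dist G y x̂  ≡⟨ cong (dist G y) (antipode-unique (eqℕ-sound xz≡D)) ⟨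
      dist G y z  ≡⟨ eqℕ-sound yz≡D∸i ⟩
      D ∸ i       ∎
    where
    open ≡-Reasoning
    antipode-unique : ∀ {z} → dist G x z ≡ D → z ≡ x̂
    antipode-unique {z} xz≡D =
      let (_ , _ , unique) = antipodal x in trans (unique z xz≡D) (sym (unique x̂ xx̂≡D))

module TerwilligerModules {c ℓ : Level} (F : Field c ℓ) where
  open LinAlg F
  open Field F using (reflexive)

  IsTModule-⊆ : ∀ {p n} {G : Graph n} {D x y} → InT G D y ⊆ InT G D x →
                {W : Vector n → Set p} → IsTModule G D x W → IsTModule G D y W
  IsTModule-⊆ y⊆x (subspace , closed) = subspace , λ B B∈ → closed B (y⊆x B∈)

  IsIrreducibleTModule-≐ : ∀ {p n} {G : Graph n} {D x y} →
                           InT G D x ≐ InT G D y →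
                           {W : Vector n → Set p} → IsIrreducibleTModule G D x W → IsIrreducibleTModule G D y W
  IsIrreducibleTModule-≐ (x⊆y , y⊆x) (module′ , nonzero , noProper) =
    IsTModule-⊆ y⊆x module′ , nonzero , λ U U-module → noProper U (IsTModule-⊆ x⊆y U-module)

  module _ {n} {G : Graph n} {D : ℕ} (regular : IsDistanceRegular G)
    (diameter : IsDiameter G D) (antipodal : IsAntipodalDoubleCover G D) where
    open ConnectedDistance (proj₁ regular) using (dist-sym)
    open AntipodalDistanceRegular regular diameter antipodal

    dualIdem-antipode : ∀ {x x̂} → dist G x x̂ ≡ D → ∀ {i} → i ≤ D → dualIdem G x (D ∸ i) ≈ₘ dualIdem G x̂ i
    dualIdem-antipode {x} {x̂} xx̂≡D {i} i≤D y z =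
      reflexive (cong (λ b → fromBool (does (y ≟ z) ∧ b)) same-shell)
      where
      open ≡-Reasoning
      same-shell : eqℕ (dist G x y) (D ∸ i) ≡ eqℕ (dist G x̂ y) i
      same-shell = begin
        eqℕ (dist G x y) (D ∸ i)  ≡⟨ eqℕ-∸-swap (proj₁ diameter x y) i≤D ⟩
        eqℕ (D ∸ dist G x y) i    ≡⟨ cong (λ d → eqℕ d i) (dist-antipode xx̂≡D y) ⟨
        eqℕ (dist G x̂ y) i        ∎

    InT-antipode : ∀ {x x̂} → dist G x x̂ ≡ D → InT G D x̂ ⊆ InT G D x
    InT-antipode xx̂≡D gen-A          = gen-A
    InT-antipode xx̂≡D (gen-E i i≤D)  = cl-≈ (dualIdem-antipode xx̂≡D i≤D) (gen-E (D ∸ i) (m∸n≤m D i))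
    InT-antipode xx̂≡D gen-1          = gen-1
    InT-antipode xx̂≡D (cl-+ M∈ N∈)   = cl-+ (InT-antipode xx̂≡D M∈) (InT-antipode xx̂≡D N∈)
    InT-antipode xx̂≡D (cl-· a M∈)    = cl-· a (InT-antipode xx̂≡D M∈)
    InT-antipode xx̂≡D (cl-* M∈ N∈)   = cl-* (InT-antipode xx̂≡D M∈) (InT-antipode xx̂≡D N∈)
    InT-antipode xx̂≡D (cl-≈ M≈N M∈)  = cl-≈ M≈N (InT-antipode xx̂≡D M∈)

    InT-antipode-≐ : ∀ {x x̂} → dist G x x̂ ≡ D → InT G D x ≐ InT G D x̂
    InT-antipode-≐ {x} {x̂} xx̂≡D = InT-antipode (trans (dist-sym x̂ x) xx̂≡D) , InT-antipode xx̂≡D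

lemma6p1 : ∀ {c ℓ p : Level} (F : Field c ℓ) {n : ℕ} (G : Graph n) (D : ℕ) →
    IsDistanceRegular G → IsDiameter G D → 3 ≤ D → IsAntipodalDoubleCover G D →
    (x x̂ : Fin n) → dist G x x̂ ≡ D →
    (W : LinAlg.Vector F n → Set p) →
    LinAlg.IsIrreducibleTModule F G D x W ⇔ LinAlg.IsIrreducibleTModule F G D x̂ W
lemma6p1 F G D regular diameter _ antipodal x x̂ xx̂≡D W =
  mk⇔ (IsIrreducibleTModule-≐ T[x]≐T[x̂]) (IsIrreducibleTModule-≐ (≐-sym T[x]≐T[x̂]))
  where
  open TerwilligerModules F
  T[x]≐T[x̂] : LinAlg.InT F G D x ≐ LinAlg.InT F G D x̂
  T[x]≐T[x̂] = InT-antipode-≐ regular diameter antipodal xx̂≡D
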